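{- There is an absolute constant $C>0$ such that the following holds. Let $\mathcal L$ be a finite set of curves in $\mathbb R^2$ and $\mathcal P$ a finite set of points in $\mathbb R^2$ forming a simple intersection arrangement, i.e. any two distinct curves of $\mathcal L$ have at most one common point of $\mathcal P$, and any two distinct points of $\mathcal P$ lie on at most one common curve of $\mathcal L$. Let $\mu,\nu\geq 1$ be integers, and assign to each $l\in\mathcal L$ a weight $\mu(l)\in\{1,\dots,\mu\}$ and to each $p\in\mathcal P$ a weight $\nu(p)\in\{1,\dots,\nu\}$, with net weights $m=\sum_{l\in\mathcal L}\mu(l)$ and $n=\sum_{p\in\mathcal P}\nu(p)$. Define the number of weighted incidences $$I=\sum_{l\in\mathcal L,\,p\in\mathcal P}\mu(l)\nu(p)\delta_{lp},$$ where $\delta_{lp}=1$ if $p\in l$ and $0$ otherwise. Then $$I\leq C\left((\mu\nu)^{1/3}(mn)^{2/3}+\nu m+\mu n\right).$$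
   Context: The curves are assumed to be of the type for which the Szemerédi–Trotter incidence bound holds in Székely's form (e.g. lines, or translates of the graph of a strictly convex function): for $m'$ such curves and $n'$ points in a simple intersection arrangement, the number of incidences is at most a constant times $(m'n')^{2/3}+m'+n'$. -}

module Defs where

open import Data.Nat using (ℕ; zero; suc; _+_; _*_; _^_; _≤_)
open import Data.Bool using (Bool; true; false; if_then_else_; _∧_)
open import Data.Fin using (Fin; zero; suc)
open import Data.Fin.Subset using (Subset)
open import Data.Vec using (lookup)
open import Data.Empty using (⊥)
open import Relation.Binary.PropositionalEquality using (_≡_)
open import Relation.Nullary using (¬_)

sumFin : (n : ℕ) → (Fin n → ℕ) → ℕ
sumFin zero    f = 0
sumFin (suc n) f = f zero + sumFin n (λ i → f (suc i))

δ : Bool → ℕ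
δ b = if b then 1 else 0

-- An abstract (finite) incidence structure: curves Fin a, points Fin b,
-- inc l p = true iff p ∈ l.
Incidence : ℕ → ℕ → Set
Incidence a b = Fin a → Fin b → Bool

SimpleArrangement : {a b : ℕ} → Incidence a b → Set
SimpleArrangement {a} {b} inc =
  ((l l′ : Fin a) → ¬ (l ≡ l′) → (p p′ : Fin b) →
     inc l p ≡ true → inc l′ p ≡ true → inc l p′ ≡ true → inc l′ p′ ≡ true → p ≡ p′)
  × ((p p′ : Fin b) → ¬ (p ≡ p′) → (l l′ : Fin a) →
     inc l p ≡ true → inc l p′ ≡ true → inc l′ p ≡ true → inc l′ p′ ≡ true → l ≡ l′)
  where open import Data.Product using (_×_)

card : {n : ℕ} → Subset n → ℕ
card {n} S = sumFin n (λ i → δ (lookup S i))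

subIncidences : {a b : ℕ} → Incidence a b → Subset a → Subset b → ℕ
subIncidences {a} {b} inc S T =
  sumFin a (λ l → sumFin b (λ p → δ (lookup S l ∧ lookup T p ∧ inc l p)))

-- Szemerédi–Trotter bound in Székely's form, with constant K, holding for every
-- subconfiguration (m' curves, n' points) of the arrangement; stated in cubed
-- form  I'^3 ≤ K ((m'n')^2 + m'^3 + n'^3), equivalent to
-- I' ≤ K' ((m'n')^{2/3} + m' + n') up to the value of the constant.
SzemerediTrotter : {a b : ℕ} → ℕ → Incidence a b → Set
SzemerediTrotter {a} {b} K inc =
  (S : Subset a) (T : Subset b) →
  subIncidences inc S T ^ 3 ≤ K * ((card S * card T) ^ 2 + card S ^ 3 + card T ^ 3)

weightedIncidences : {a b : ℕ} → Incidence a b → (Fin a → ℕ) → (Fin b → ℕ) → ℕ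
weightedIncidences {a} {b} inc wμ wν =
  sumFin a (λ l → sumFin b (λ p → wμ l * wν p * δ (inc l p)))

-- Slice the weights into layers: for s < μ let A_s be the curves of weight > s, and for
-- t < ν let B_t be the points of weight > t. Then I = Σ_{s,t} I(A_s, B_t), Σ_s |A_s| = m and
-- Σ_t |B_t| = n. The unweighted bound on each of the μν subarrangements gives
-- I(A_s, B_t) ≤ y_st + 3K|A_s| + 3K|B_t| with y_st³ ≤ 3K (|A_s| |B_t|)²; the linear parts add up
-- to 3K (νm + μn), and Hölder's inequality gives (Σ y_st)³ ≤ μν · 3K · (mn)². All bounds are
-- kept in cubed form, so the argument never leaves ℕ.
module Submission where

open import Defs
open import Data.Nat using (ℕ; _+_; _*_; _^_; _≤_)
open import Data.Fin using (Fin)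
open import Data.Product using (Σ; _×_)

open import Data.Bool using (true; false; _∧_)
open import Data.Fin using (zero; suc; toℕ)
open import Data.Fin.Subset using (Subset)
open import Data.Nat using (zero; suc; z≤n; s≤s; NonZero; _⊔_; _<ᵇ_)
open import Data.Nat.Properties
open import Algebra.Properties.Semiring.Sum +-*-semiring
  using (sum; sum-cong-≗; ∑-comm; ∑-distrib-+; *-distribˡ-sum; *-distribʳ-sum)
open import Data.Nat.Solver using (module +-*-Solver)
open import Data.Nat.Tactic.RingSolver using (solve-∀)
open import Data.Product using (_,_; proj₁; proj₂)
open import Data.Sum using (_⊎_; inj₁; inj₂; [_,_]′)
import Data.Sum as Sum
open import Data.Vec using (lookup; tabulate)
open import Data.Vec.Properties using (lookup∘tabulate)
open import Function using (_∘_)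
open import Relation.Binary.PropositionalEquality

open +-*-Solver using (solve; _:=_; _:+_; _:*_; _:^_; con)

m≤m^[1+n] : ∀ m n → m ≤ m ^ suc n
m≤m^[1+n] zero      n = z≤n
m≤m^[1+n] m@(suc _) n = m≤m*n m (m ^ n) {{m^n≢0 m n}}

^-cancelˡ-≤ : ∀ n .{{_ : NonZero n}} {m o} → m ^ n ≤ o ^ n → m ≤ o
^-cancelˡ-≤ n mⁿ≤oⁿ = ≮⇒≥ (λ o<m → <⇒≱ (^-monoˡ-< n o<m) mⁿ≤oⁿ)

2*[m*n]≤m*m+n*n : ∀ m n → 2 * (m * n) ≤ m * m + n * n
2*[m*n]≤m*m+n*n m n = [ ordered , swapped ]′ (≤-total m n)
  where
  square-gap : ∀ m d → 2 * (m * (m + d)) + d * d ≡ m * m + (m + d) * (m + d)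
  square-gap = solve-∀
  ordered : ∀ {m n} → m ≤ n → 2 * (m * n) ≤ m * m + n * n
  ordered {m} m≤n with d , refl ← m≤n⇒∃[o]m+o≡n m≤n =
    ≤-trans (m≤m+n _ (d * d)) (≤-reflexive (square-gap m d))
  swapped : n ≤ m → 2 * (m * n) ≤ m * m + n * n
  swapped n≤m = subst₂ _≤_ (cong (2 *_) (*-comm n m)) (+-comm (n * n) (m * m)) (ordered n≤m)

-- Sum of squares: 2 ((a + b + c)³ - 27abc) = Σ_cyc (a - b)² (a + b + 7c), written without subtraction.
27*[m*n*o]≤[m+n+o]^3 : ∀ a b c → 27 * (a * b * c) ≤ (a + b + c) ^ 3
27*[m*n*o]≤[m+n+o]^3 a b c = *-cancelˡ-≤ 2 (+-cancelʳ-≤ X _ _ (begin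
  2 * (27 * (a * b * c)) + X  ≤⟨ +-monoʳ-≤ (2 * (27 * (a * b * c))) X≤Y ⟩
  2 * (27 * (a * b * c)) + Y  ≡⟨ sos ⟨
  2 * (a + b + c) ^ 3 + X     ∎))
  where
  open ≤-Reasoning
  X Y : ℕ
  X = 2 * (a * b) * (a + b + 7 * c) + 2 * (b * c) * (b + c + 7 * a) + 2 * (c * a) * (c + a + 7 * b)
  Y = (a * a + b * b) * (a + b + 7 * c) + (b * b + c * c) * (b + c + 7 * a) + (c * c + a * a) * (c + a + 7 * b)
  X≤Y : X ≤ Y
  X≤Y = +-mono-≤ (+-mono-≤ (weigh a b c) (weigh b c a)) (weigh c a b)
    where
    weigh : ∀ m n o → 2 * (m * n) * (m + n + 7 * o) ≤ (m * m + n * n) * (m + n + 7 * o)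
    weigh m n o = *-monoˡ-≤ (m + n + 7 * o) (2*[m*n]≤m*m+n*n m n)
  sos : 2 * (a + b + c) ^ 3 + X ≡ 2 * (27 * (a * b * c)) + Y
  sos = solve 3 (λ a b c →
      con 2 :* (a :+ b :+ c) :^ 3
        :+ (con 2 :* (a :* b) :* (a :+ b :+ con 7 :* c) :+ con 2 :* (b :* c) :* (b :+ c :+ con 7 :* a)
            :+ con 2 :* (c :* a) :* (c :+ a :+ con 7 :* b))
    := con 2 :* (con 27 :* (a :* b :* c))
        :+ ((a :* a :+ b :* b) :* (a :+ b :+ con 7 :* c) :+ (b :* b :+ c :* c) :* (b :+ c :+ con 7 :* a)
            :+ (c :* c :+ a :* a) :* (c :+ a :+ con 7 :* b)))
    refl a b c

hölder³-mixed : ∀ x X u U v V w W → x ^ 3 ≤ u * v * w → X ^ 3 ≤ U * V * W →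
                3 * (x * x * X) ≤ u * v * W + u * V * w + U * v * w
hölder³-mixed x X u U v V w W x³≤uvw X³≤UVW = ^-cancelˡ-≤ 3 (begin
  (3 * (x * x * X)) ^ 3                          ≡⟨ cube-of-mixed ⟩
  27 * (x ^ 3 * x ^ 3 * X ^ 3)                   ≤⟨ *-monoʳ-≤ 27 (*-mono-≤ (*-mono-≤ x³≤uvw x³≤uvw) X³≤UVW) ⟩
  27 * (u * v * w * (u * v * w) * (U * V * W))   ≡⟨ cong (27 *_) (regroup u v w U V W) ⟩
  27 * (u * v * W * (u * V * w) * (U * v * w))   ≤⟨ 27*[m*n*o]≤[m+n+o]^3 (u * v * W) (u * V * w) (U * v * w) ⟩
  (u * v * W + u * V * w + U * v * w) ^ 3        ∎)
  where
  open ≤-Reasoning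
  cube-of-mixed : (3 * (x * x * X)) ^ 3 ≡ 27 * (x ^ 3 * x ^ 3 * X ^ 3)
  cube-of-mixed = solve 2 (λ x X → (con 3 :* (x :* x :* X)) :^ 3 := con 27 :* (x :^ 3 :* x :^ 3 :* X :^ 3)) refl x X
  regroup : ∀ u v w U V W → u * v * w * (u * v * w) * (U * V * W) ≡ u * v * W * (u * V * w) * (U * v * w)
  regroup = solve-∀

hölder³-+ : ∀ x X u U v V w W → x ^ 3 ≤ u * v * w → X ^ 3 ≤ U * V * W →
            (x + X) ^ 3 ≤ (u + U) * (v + V) * (w + W)
hölder³-+ x X u U v V w W x³≤uvw X³≤UVW = begin
  (x + X) ^ 3                                          ≡⟨ binomial ⟩
  x ^ 3 + 3 * (x * x * X) + 3 * (X * X * x) + X ^ 3    ≤⟨ +-mono-≤ (+-mono-≤ (+-mono-≤ x³≤uvw mixed) mixed′) X³≤UVW ⟩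
  u * v * w + (u * v * W + u * V * w + U * v * w)
    + (U * V * w + U * v * W + u * V * W) + U * V * W  ≡⟨ expand u v w U V W ⟨
  (u + U) * (v + V) * (w + W)                          ∎
  where
  open ≤-Reasoning
  mixed : 3 * (x * x * X) ≤ u * v * W + u * V * w + U * v * w
  mixed = hölder³-mixed x X u U v V w W x³≤uvw X³≤UVW
  mixed′ : 3 * (X * X * x) ≤ U * V * w + U * v * W + u * V * W
  mixed′ = hölder³-mixed X x U u V v W w X³≤UVW x³≤uvw
  binomial : (x + X) ^ 3 ≡ x ^ 3 + 3 * (x * x * X) + 3 * (X * X * x) + X ^ 3
  binomial = solve 2 (λ x X → (x :+ X) :^ 3 := x :^ 3 :+ con 3 :* (x :* x :* X) :+ con 3 :* (X :* X :* x) :+ X :^ 3) refl x X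
  expand : ∀ u v w U V W → (u + U) * (v + V) * (w + W) ≡ u * v * w + (u * v * W + u * V * w + U * v * w)
    + (U * V * w + U * v * W + u * V * W) + U * V * W
  expand = solve-∀

[m+n+o]^3≤9*[m^3+n^3+o^3] : ∀ a b c → (a + b + c) ^ 3 ≤ 9 * (a ^ 3 + b ^ 3 + c ^ 3)
[m+n+o]^3≤9*[m^3+n^3+o^3] a b c =
  hölder³-+ (a + b) c 2 1 2 1 (a ^ 3 + b ^ 3) (c ^ 3)
    (hölder³-+ a b 1 1 1 1 (a ^ 3) (b ^ 3) (unit a) (unit b)) (unit c)
  where
  unit : ∀ x → x ^ 3 ≤ 1 * 1 * x ^ 3
  unit x = ≤-reflexive (sym (*-identityˡ (x ^ 3)))

^3≤*^3⇒≤* : ∀ c a {x} → x ^ 3 ≤ c * a ^ 3 → x ≤ c * a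
^3≤*^3⇒≤* c a {x} x³≤ca³ = ^-cancelˡ-≤ 3 (begin
  x ^ 3          ≤⟨ x³≤ca³ ⟩
  c * a ^ 3      ≤⟨ *-monoˡ-≤ (a ^ 3) (m≤m^[1+n] c 2) ⟩
  c ^ 3 * a ^ 3  ≡⟨ solve 2 (λ c a → c :^ 3 :* a :^ 3 := (c :* a) :^ 3) refl c a ⟩
  (c * a) ^ 3    ∎)
  where open ≤-Reasoning

⊔₃-sel : ∀ a b c → a ⊔ b ⊔ c ≡ a ⊎ a ⊔ b ⊔ c ≡ b ⊎ a ⊔ b ⊔ c ≡ c
⊔₃-sel a b c with ⊔-sel (a ⊔ b) c | ⊔-sel a b
... | inj₂ ≡c  | _       = inj₂ (inj₂ ≡c)
... | inj₁ ≡ab | inj₁ ≡a = inj₁ (trans ≡ab ≡a)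
... | inj₁ ≡ab | inj₂ ≡b = inj₂ (inj₁ (trans ≡ab ≡b))

≤-split₃ : ∀ {m} k a b c → m ≤ k * (a + b + c) → m ≤ 3 * k * a ⊎ m ≤ 3 * k * b ⊎ m ≤ 3 * k * c
≤-split₃ {m} k a b c m≤k[a+b+c] = Sum.map below (Sum.map below below) (⊔₃-sel a b c)
  where
  open ≤-Reasoning
  M : ℕ
  M = a ⊔ b ⊔ c
  below : ∀ {x} → M ≡ x → m ≤ 3 * k * x
  below refl = begin
    m                ≤⟨ m≤k[a+b+c] ⟩
    k * (a + b + c)  ≤⟨ *-monoʳ-≤ k (+-mono-≤ (+-mono-≤ a≤M b≤M) (m≤n⊔m (a ⊔ b) c)) ⟩
    k * (M + M + M)  ≡⟨ triple k M ⟩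
    3 * k * M        ∎
    where
    a≤M : a ≤ M
    a≤M = ≤-trans (m≤m⊔n a b) (m≤m⊔n (a ⊔ b) c)
    b≤M : b ≤ M
    b≤M = ≤-trans (m≤n⊔m a b) (m≤m⊔n (a ⊔ b) c)
    triple : ∀ k x → k * (x + x + x) ≡ 3 * k * x
    triple = solve-∀

split-cubic-bound : ∀ K x α β → x ^ 3 ≤ K * ((α * β) ^ 2 + α ^ 3 + β ^ 3) →
  Σ ℕ λ y → y ^ 3 ≤ 3 * K * (α * β) * (α * β) × x ≤ y + 3 * K * α + 3 * K * β
split-cubic-bound K x α β x³≤ with ≤-split₃ K ((α * β) ^ 2) (α ^ 3) (β ^ 3) x³≤
... | inj₁ x³≤3K[αβ]² = x , ≤-trans x³≤3K[αβ]² (≤-reflexive square) , ≤-trans (m≤m+n x _) (m≤m+n _ _)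
  where
  square : 3 * K * (α * β) ^ 2 ≡ 3 * K * (α * β) * (α * β)
  square = solve 2 (λ k γ → k :* γ :^ 2 := k :* γ :* γ) refl (3 * K) (α * β)
... | inj₂ (inj₁ x³≤3Kα³) = 0 , z≤n , ≤-trans (^3≤*^3⇒≤* (3 * K) α x³≤3Kα³) (≤-trans (m≤n+m _ 0) (m≤m+n _ _))
... | inj₂ (inj₂ x³≤3Kβ³) = 0 , z≤n , ≤-trans (^3≤*^3⇒≤* (3 * K) β x³≤3Kβ³) (m≤n+m _ _)

sumFin≡sum : ∀ n (f : Fin n → ℕ) → sumFin n f ≡ sum f
sumFin≡sum zero    f = refl
sumFin≡sum (suc n) f = cong (f zero +_) (sumFin≡sum n (f ∘ suc))

sumFin-cong : ∀ n {f g : Fin n → ℕ} → (∀ i → f i ≡ g i) → sumFin n f ≡ sumFin n g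
sumFin-cong zero    f≗g = refl
sumFin-cong (suc n) f≗g = cong₂ _+_ (f≗g zero) (sumFin-cong n (f≗g ∘ suc))

sumFin-mono-≤ : ∀ n {f g : Fin n → ℕ} → (∀ i → f i ≤ g i) → sumFin n f ≤ sumFin n g
sumFin-mono-≤ zero    f≤g = z≤n
sumFin-mono-≤ (suc n) f≤g = +-mono-≤ (f≤g zero) (sumFin-mono-≤ n (f≤g ∘ suc))

sumFin-const : ∀ n c → sumFin n (λ _ → c) ≡ n * c
sumFin-const zero    c = refl
sumFin-const (suc n) c = cong (c +_) (sumFin-const n c)

sumFin-distrib-+ : ∀ n (f g : Fin n → ℕ) → sumFin n (λ i → f i + g i) ≡ sumFin n f + sumFin n g
sumFin-distrib-+ n f g = begin
  sumFin n (λ i → f i + g i)  ≡⟨ sumFin≡sum n _ ⟩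
  sum (λ i → f i + g i)       ≡⟨ ∑-distrib-+ f g ⟩
  sum f + sum g               ≡⟨ cong₂ _+_ (sumFin≡sum n f) (sumFin≡sum n g) ⟨
  sumFin n f + sumFin n g     ∎
  where open ≡-Reasoning

*-distribˡ-sumFin : ∀ n c (f : Fin n → ℕ) → c * sumFin n f ≡ sumFin n (λ i → c * f i)
*-distribˡ-sumFin n c f = begin
  c * sumFin n f              ≡⟨ cong (c *_) (sumFin≡sum n f) ⟩
  c * sum f                   ≡⟨ *-distribˡ-sum c f ⟩
  sum (λ i → c * f i)         ≡⟨ sumFin≡sum n _ ⟨
  sumFin n (λ i → c * f i)    ∎
  where open ≡-Reasoning

*-distribʳ-sumFin : ∀ n c (f : Fin n → ℕ) → sumFin n f * c ≡ sumFin n (λ i → f i * c)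
*-distribʳ-sumFin n c f = begin
  sumFin n f * c              ≡⟨ cong (_* c) (sumFin≡sum n f) ⟩
  sum f * c                   ≡⟨ *-distribʳ-sum c f ⟩
  sum (λ i → f i * c)         ≡⟨ sumFin≡sum n _ ⟨
  sumFin n (λ i → f i * c)    ∎
  where open ≡-Reasoning

sumFin-comm : ∀ m n (f : Fin m → Fin n → ℕ) →
              sumFin m (λ i → sumFin n (f i)) ≡ sumFin n (λ j → sumFin m (λ i → f i j))
sumFin-comm m n f = begin
  sumFin m (λ i → sumFin n (f i))         ≡⟨ nested m n f ⟩
  sum (λ i → sum (f i))                   ≡⟨ ∑-comm f ⟩
  sum (λ j → sum (λ i → f i j))           ≡⟨ nested n m (λ j i → f i j) ⟨
  sumFin n (λ j → sumFin m (λ i → f i j)) ∎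
  where
  open ≡-Reasoning
  nested : ∀ m n (g : Fin m → Fin n → ℕ) → sumFin m (λ i → sumFin n (g i)) ≡ sum (λ i → sum (g i))
  nested m n g = trans (sumFin≡sum m _) (sum-cong-≗ (λ i → sumFin≡sum n (g i)))

sumFin-comm² : ∀ m n m′ n′ (f : Fin m → Fin n → Fin m′ → Fin n′ → ℕ) →
  sumFin m (λ i → sumFin n (λ j → sumFin m′ (λ k → sumFin n′ (f i j k)))) ≡
  sumFin m′ (λ k → sumFin n′ (λ l → sumFin m (λ i → sumFin n (λ j → f i j k l))))
sumFin-comm² m n m′ n′ f = begin
  sumFin m (λ i → sumFin n (λ j → sumFin m′ (λ k → sumFin n′ (f i j k))))
    ≡⟨ sumFin-cong m (λ i → sumFin-comm n m′ _) ⟩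
  sumFin m (λ i → sumFin m′ (λ k → sumFin n (λ j → sumFin n′ (f i j k))))
    ≡⟨ sumFin-comm m m′ _ ⟩
  sumFin m′ (λ k → sumFin m (λ i → sumFin n (λ j → sumFin n′ (f i j k))))
    ≡⟨ sumFin-cong m′ (λ k → sumFin-cong m (λ i → sumFin-comm n n′ _)) ⟩
  sumFin m′ (λ k → sumFin m (λ i → sumFin n′ (λ l → sumFin n (λ j → f i j k l))))
    ≡⟨ sumFin-cong m′ (λ k → sumFin-comm m n′ _) ⟩
  sumFin m′ (λ k → sumFin n′ (λ l → sumFin m (λ i → sumFin n (λ j → f i j k l)))) ∎
  where open ≡-Reasoning

sumFin²-separable : ∀ μ ν (f : Fin μ → Fin ν → ℕ) (g : Fin μ → ℕ) (h : Fin ν → ℕ) →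
  sumFin μ (λ s → sumFin ν (λ t → f s t + g s + h t)) ≡
  sumFin μ (λ s → sumFin ν (f s)) + ν * sumFin μ g + μ * sumFin ν h
sumFin²-separable μ ν f g h = begin
  sumFin μ (λ s → sumFin ν (λ t → f s t + g s + h t))
    ≡⟨ sumFin-cong μ (λ s → trans (sumFin-distrib-+ ν _ h) (cong (_+ sumFin ν h) (inner s))) ⟩
  sumFin μ (λ s → sumFin ν (f s) + ν * g s + sumFin ν h)
    ≡⟨ sumFin-distrib-+ μ _ _ ⟩
  sumFin μ (λ s → sumFin ν (f s) + ν * g s) + sumFin μ (λ _ → sumFin ν h)
    ≡⟨ cong₂ _+_ (sumFin-distrib-+ μ _ _) (sumFin-const μ (sumFin ν h)) ⟩
  sumFin μ (λ s → sumFin ν (f s)) + sumFin μ (λ s → ν * g s) + μ * sumFin ν h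
    ≡⟨ cong (λ z → sumFin μ (λ s → sumFin ν (f s)) + z + μ * sumFin ν h) (*-distribˡ-sumFin μ ν g) ⟨
  sumFin μ (λ s → sumFin ν (f s)) + ν * sumFin μ g + μ * sumFin ν h  ∎
  where
  open ≡-Reasoning
  inner : ∀ s → sumFin ν (λ t → f s t + g s) ≡ sumFin ν (f s) + ν * g s
  inner s = trans (sumFin-distrib-+ ν (f s) _) (cong (sumFin ν (f s) +_) (sumFin-const ν (g s)))

sumFin²-* : ∀ μ ν (f : Fin μ → ℕ) (g : Fin ν → ℕ) →
  sumFin μ (λ s → sumFin ν (λ t → f s * g t)) ≡ sumFin μ f * sumFin ν g
sumFin²-* μ ν f g = begin
  sumFin μ (λ s → sumFin ν (λ t → f s * g t)) ≡⟨ sumFin-cong μ (λ s → *-distribˡ-sumFin ν (f s) g) ⟨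
  sumFin μ (λ s → f s * sumFin ν g)           ≡⟨ *-distribʳ-sumFin μ (sumFin ν g) f ⟨
  sumFin μ f * sumFin ν g                     ∎
  where open ≡-Reasoning

hölder³ : ∀ n (x u v w : Fin n → ℕ) → (∀ i → x i ^ 3 ≤ u i * v i * w i) →
          sumFin n x ^ 3 ≤ sumFin n u * sumFin n v * sumFin n w
hölder³ zero    x u v w x³≤uvw = z≤n
hölder³ (suc n) x u v w x³≤uvw =
  hölder³-+ (x zero) _ (u zero) _ (v zero) _ (w zero) _ (x³≤uvw zero)
    (hölder³ n (x ∘ suc) (u ∘ suc) (v ∘ suc) (w ∘ suc) (x³≤uvw ∘ suc))

δ-∧ : ∀ x y → δ (x ∧ y) ≡ δ x * δ y
δ-∧ false y = refl
δ-∧ true  y = sym (+-identityʳ (δ y))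

sumFin-δ-<ᵇ : ∀ {μ k} → k ≤ μ → sumFin μ (λ s → δ (toℕ s <ᵇ k)) ≡ k
sumFin-δ-<ᵇ {zero}  {zero}  _         = refl
sumFin-δ-<ᵇ {suc μ} {zero}  _         = sumFin-δ-<ᵇ {μ} z≤n
sumFin-δ-<ᵇ {suc μ} {suc k} (s≤s k≤μ) = cong suc (sumFin-δ-<ᵇ k≤μ)

sumFin-δ-<ᵇ-* : ∀ {μ k} → k ≤ μ → ∀ c → sumFin μ (λ s → δ (toℕ s <ᵇ k) * c) ≡ k * c
sumFin-δ-<ᵇ-* {μ} k≤μ c = trans (sym (*-distribʳ-sumFin μ c _)) (cong (_* c) (sumFin-δ-<ᵇ k≤μ))

layer : ∀ {a} → (Fin a → ℕ) → ℕ → Subset a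
layer w s = tabulate (λ l → s <ᵇ w l)

lookup-layer : ∀ {a} (w : Fin a → ℕ) s l → lookup (layer w s) l ≡ (s <ᵇ w l)
lookup-layer w s = lookup∘tabulate (λ l → s <ᵇ w l)

sumFin-card-layer : ∀ {a μ} (w : Fin a → ℕ) → (∀ l → w l ≤ μ) →
                    sumFin μ (λ s → card (layer w (toℕ s))) ≡ sumFin a w
sumFin-card-layer {a} {μ} w w≤μ = begin
  sumFin μ (λ s → sumFin a (λ l → δ (lookup (layer w (toℕ s)) l)))  ≡⟨ sumFin-comm μ a _ ⟩
  sumFin a (λ l → sumFin μ (λ s → δ (lookup (layer w (toℕ s)) l)))  ≡⟨ sumFin-cong a count ⟩
  sumFin a w                                                        ∎
  where
  open ≡-Reasoning
  count : ∀ l → sumFin μ (λ s → δ (lookup (layer w (toℕ s)) l)) ≡ w l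
  count l = trans (sumFin-cong μ (λ s → cong δ (lookup-layer w (toℕ s) l))) (sumFin-δ-<ᵇ (w≤μ l))

weightedIncidences≡sumFin-layers : ∀ {a b μ ν} (inc : Incidence a b) {wμ : Fin a → ℕ} {wν : Fin b → ℕ} →
  (∀ l → wμ l ≤ μ) → (∀ p → wν p ≤ ν) →
  weightedIncidences inc wμ wν ≡
  sumFin μ (λ s → sumFin ν (λ t → subIncidences inc (layer wμ (toℕ s)) (layer wν (toℕ t))))
weightedIncidences≡sumFin-layers {a} {b} {μ} {ν} inc {wμ} {wν} wμ≤μ wν≤ν = begin
  sumFin a (λ l → sumFin b (λ p → wμ l * wν p * δ (inc l p)))
    ≡⟨ sumFin-cong a (λ l → sumFin-cong b (λ p → sym (sumFin-blocks l p))) ⟩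
  sumFin a (λ l → sumFin b (λ p → sumFin μ (λ s → sumFin ν (λ t → block l p s t))))
    ≡⟨ sumFin-comm² a b μ ν block ⟩
  sumFin μ (λ s → sumFin ν (λ t → sumFin a (λ l → sumFin b (λ p → block l p s t))))  ∎
  where
  open ≡-Reasoning
  block : Fin a → Fin b → Fin μ → Fin ν → ℕ
  block l p s t = δ (lookup (layer wμ (toℕ s)) l ∧ lookup (layer wν (toℕ t)) p ∧ inc l p)
  sumFin-blocks : ∀ l p → sumFin μ (λ s → sumFin ν (λ t → block l p s t)) ≡ wμ l * wν p * δ (inc l p)
  sumFin-blocks l p = begin
    sumFin μ (λ s → sumFin ν (λ t → block l p s t))
      ≡⟨ sumFin-cong μ (λ s → sumFin-cong ν (λ t → factor s t)) ⟩
    sumFin μ (λ s → sumFin ν (λ t → δ (toℕ s <ᵇ wμ l) * (δ (toℕ t <ᵇ wν p) * δ (inc l p))))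
      ≡⟨ sumFin-cong μ (λ s → *-distribˡ-sumFin ν (δ (toℕ s <ᵇ wμ l)) _) ⟨
    sumFin μ (λ s → δ (toℕ s <ᵇ wμ l) * sumFin ν (λ t → δ (toℕ t <ᵇ wν p) * δ (inc l p)))
      ≡⟨ sumFin-cong μ (λ s → cong (δ (toℕ s <ᵇ wμ l) *_) (sumFin-δ-<ᵇ-* (wν≤ν p) _)) ⟩
    sumFin μ (λ s → δ (toℕ s <ᵇ wμ l) * (wν p * δ (inc l p)))
      ≡⟨ sumFin-δ-<ᵇ-* (wμ≤μ l) _ ⟩
    wμ l * (wν p * δ (inc l p))
      ≡⟨ *-assoc (wμ l) _ _ ⟨
    wμ l * wν p * δ (inc l p)  ∎
    where
    factor : ∀ s t → block l p s t ≡ δ (toℕ s <ᵇ wμ l) * (δ (toℕ t <ᵇ wν p) * δ (inc l p))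
    factor s t rewrite lookup-layer wμ (toℕ s) l | lookup-layer wν (toℕ t) p =
      trans (δ-∧ (toℕ s <ᵇ wμ l) _) (cong (δ (toℕ s <ᵇ wμ l) *_) (δ-∧ (toℕ t <ᵇ wν p) _))

module _ (K : ℕ) {a b : ℕ} {inc : Incidence a b} (szemerédiTrotter : SzemerediTrotter K inc)
         {μ ν : ℕ} {wμ : Fin a → ℕ} {wν : Fin b → ℕ}
         (wμ≤μ : ∀ l → wμ l ≤ μ) (wν≤ν : ∀ p → wν p ≤ ν) where

  private
    c m n : ℕ
    c = 3 * K
    m = sumFin a wμ
    n = sumFin b wν

    A : Fin μ → Subset a
    A s = layer wμ (toℕ s)
    B : Fin ν → Subset b
    B t = layer wν (toℕ t)
    α : Fin μ → ℕ
    α s = card (A s)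
    β : Fin ν → ℕ
    β t = card (B t)

    split : ∀ s t → Σ ℕ λ y → y ^ 3 ≤ c * (α s * β t) * (α s * β t)
                             × subIncidences inc (A s) (B t) ≤ y + c * α s + c * β t
    split s t = split-cubic-bound K _ (α s) (β t) (szemerédiTrotter (A s) (B t))

    y : Fin μ → Fin ν → ℕ
    y s t = proj₁ (split s t)
    Y : ℕ
    Y = sumFin μ (λ s → sumFin ν (y s))

    sumFin-c*α : sumFin μ (λ s → c * α s) ≡ c * m
    sumFin-c*α = trans (sym (*-distribˡ-sumFin μ c α)) (cong (c *_) (sumFin-card-layer wμ wμ≤μ))
    sumFin-c*β : sumFin ν (λ t → c * β t) ≡ c * n
    sumFin-c*β = trans (sym (*-distribˡ-sumFin ν c β)) (cong (c *_) (sumFin-card-layer wν wν≤ν))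

    weightedIncidences≤ : weightedIncidences inc wμ wν ≤ Y + ν * (c * m) + μ * (c * n)
    weightedIncidences≤ = begin
      weightedIncidences inc wμ wν
        ≡⟨ weightedIncidences≡sumFin-layers inc wμ≤μ wν≤ν ⟩
      sumFin μ (λ s → sumFin ν (λ t → subIncidences inc (A s) (B t)))
        ≤⟨ sumFin-mono-≤ μ (λ s → sumFin-mono-≤ ν (λ t → proj₂ (proj₂ (split s t)))) ⟩
      sumFin μ (λ s → sumFin ν (λ t → y s t + c * α s + c * β t))
        ≡⟨ sumFin²-separable μ ν y (λ s → c * α s) (λ t → c * β t) ⟩
      Y + ν * sumFin μ (λ s → c * α s) + μ * sumFin ν (λ t → c * β t)
        ≡⟨ cong₂ (λ p q → Y + ν * p + μ * q) sumFin-c*α sumFin-c*β ⟩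
      Y + ν * (c * m) + μ * (c * n)  ∎
      where open ≤-Reasoning

    Y-cube : Y ^ 3 ≤ c * (μ * ν * (m * n) ^ 2)
    Y-cube = begin
      Y ^ 3
        ≤⟨ hölder³ μ _ _ _ _ (λ s → hölder³ ν (y s) (λ _ → c) (λ t → α s * β t) (λ t → α s * β t)
                                              (λ t → proj₁ (proj₂ (split s t)))) ⟩
      sumFin μ (λ _ → sumFin ν (λ _ → c)) * αβ * αβ
        ≡⟨ cong₂ (λ p q → p * q * q) (trans (sumFin-cong μ (λ _ → sumFin-const ν c)) (sumFin-const μ (ν * c))) sumFin-αβ ⟩
      μ * (ν * c) * (m * n) * (m * n)
        ≡⟨ solve 5 (λ c μ ν m n → μ :* (ν :* c) :* (m :* n) :* (m :* n) := c :* (μ :* ν :* (m :* n) :^ 2)) refl c μ ν m n ⟩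
      c * (μ * ν * (m * n) ^ 2)  ∎
      where
      open ≤-Reasoning
      αβ : ℕ
      αβ = sumFin μ (λ s → sumFin ν (λ t → α s * β t))
      sumFin-αβ : αβ ≡ m * n
      sumFin-αβ = trans (sumFin²-* μ ν α β) (cong₂ _*_ (sumFin-card-layer wμ wμ≤μ) (sumFin-card-layer wν wν≤ν))

  weightedIncidences-cube≤ : weightedIncidences inc wμ wν ^ 3 ≤
    9 * (3 * K + (3 * K) ^ 3) * (μ * ν * (sumFin a wμ * sumFin b wν) ^ 2
                                 + (ν * sumFin a wμ) ^ 3 + (μ * sumFin b wν) ^ 3)
  weightedIncidences-cube≤ = begin
    weightedIncidences inc wμ wν ^ 3
      ≤⟨ ^-monoˡ-≤ 3 weightedIncidences≤ ⟩
    (Y + ν * (c * m) + μ * (c * n)) ^ 3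
      ≤⟨ [m+n+o]^3≤9*[m^3+n^3+o^3] Y _ _ ⟩
    9 * (Y ^ 3 + (ν * (c * m)) ^ 3 + (μ * (c * n)) ^ 3)
      ≤⟨ *-monoʳ-≤ 9 (+-mono-≤ (+-mono-≤ Y-cube (≤-reflexive (pull-c ν m))) (≤-reflexive (pull-c μ n))) ⟩
    9 * (c * E + c ^ 3 * F + c ^ 3 * G)
      ≤⟨ *-monoʳ-≤ 9 (+-mono-≤ (+-mono-≤ (*-monoˡ-≤ E (m≤m+n c (c ^ 3))) (*-monoˡ-≤ F (m≤n+m (c ^ 3) c)))
                                (*-monoˡ-≤ G (m≤n+m (c ^ 3) c))) ⟩
    9 * ((c + c ^ 3) * E + (c + c ^ 3) * F + (c + c ^ 3) * G)
      ≡⟨ factor 9 (c + c ^ 3) E F G ⟩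
    9 * (c + c ^ 3) * (E + F + G)  ∎
    where
    open ≤-Reasoning
    E F G : ℕ
    E = μ * ν * (m * n) ^ 2
    F = (ν * m) ^ 3
    G = (μ * n) ^ 3
    pull-c : ∀ k l → (k * (c * l)) ^ 3 ≡ c ^ 3 * (k * l) ^ 3
    pull-c k l = solve 3 (λ c k l → (k :* (c :* l)) :^ 3 := c :^ 3 :* (k :* l) :^ 3) refl c k l
    factor : ∀ r d e f g → r * (d * e + d * f + d * g) ≡ r * d * (e + f + g)
    factor = solve-∀

-- Simplicity of the arrangement is used only through the Szemerédi–Trotter bound for its
-- subarrangements, which is assumed directly.
mainTheorem3 : (K : ℕ) → Σ ℕ λ C →
    (a b : ℕ) (inc : Incidence a b) → SimpleArrangement inc → SzemerediTrotter K inc →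
    (μ ν : ℕ) → 1 ≤ μ → 1 ≤ ν →
    (wμ : Fin a → ℕ) → ((l : Fin a) → 1 ≤ wμ l × wμ l ≤ μ) →
    (wν : Fin b → ℕ) → ((p : Fin b) → 1 ≤ wν p × wν p ≤ ν) →
    weightedIncidences inc wμ wν ^ 3 ≤
      C * (μ * ν * (sumFin a wμ * sumFin b wν) ^ 2
           + (ν * sumFin a wμ) ^ 3 + (μ * sumFin b wν) ^ 3)
mainTheorem3 K = 9 * (3 * K + (3 * K) ^ 3) ,
  λ a b inc _ szemerédiTrotter μ ν _ _ wμ wμ-bounds wν wν-bounds →
    weightedIncidences-cube≤ K szemerédiTrotter (proj₂ ∘ wμ-bounds) (proj₂ ∘ wν-bounds)
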